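{- Let $\mathcal{T}$ be a PCR-based cycle-joining tree with the Chain Property, $T$ a concatenation tree $\mathrm{concat}(\mathcal{T},c,\ell)$, and $\alpha_1,\dots,\alpha_t$ its node labels in RCL order, indices modulo $t$. Fix $j$; let $c_j$ be the change index of $\alpha_j=\mathtt{a}_1\cdots\mathtt{a}_n$ and write $\alpha_j=\beta_1\mathtt{y}\beta_2$ with $\beta_1=\mathtt{a}_1\cdots\mathtt{a}_{c_j-1}$, $\mathtt{y}=\mathtt{a}_{c_j}$, $\beta_2=\mathtt{a}_{c_j+1}\cdots\mathtt{a}_n$. Suppose $\alpha_j$ is not an ancestor of $\alpha_{j-1}$; then $\alpha_j$ is not the root and its parent has label $\beta_1\mathtt{y}'\beta_2$ for some symbol $\mathtt{y}'$. Let $\mathtt{x}=\mathrm{first}(\mathtt{y}'\beta_2\beta_1)$. Then: (1) if $T$ is a left concatenation tree, $\alpha_{j-1}$ has suffix $\mathtt{y}'\beta_2$; (2) if $T$ is a right concatenation tree, $\alpha_{j-1}$ has suffix $\mathtt{x}\beta_2$.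
   Context: Strings of length $n$ over a finite ordered alphabet. The period of $\alpha$ is $|\beta|$ for the shortest $\beta$ with $\alpha=\beta^q$. A PCR-based cycle-joining tree $\mathcal{T}$ is a rooted tree whose nodes are distinct rotation classes of strings, each named by its lexicographically least rotation (necklace), where the edge from node $u$ to child $v$ is labeled by a conjugate pair $(\mathtt{x}\beta,\mathtt{y}\beta)$ ($\mathtt{x}\neq\mathtt{y}$ symbols, $|\beta|=n-1$) with $\mathtt{x}\beta$ a rotation in $u$ and $\mathtt{y}\beta$ a rotation in $v$; it satisfies the Chain Property if no node has two children with edge labels sharing the same $\beta$. A chain is a maximal sequence of nodes $u_1,\dots,u_m$ ($m\ge 2$) with $u_i$ the parent of $u_{i+1}$ and edge labels $(\mathtt{x}_i\beta,\mathtt{x}_{i+1}\beta)$ with common $\beta$; for a string $\mathtt{x}_i\beta$ on such a chain, $\mathrm{first}(\mathtt{x}_i\beta)=\mathtt{x}_1$. A concatenation tree $\mathrm{concat}(\mathcal{T},c,\ell)$, $c\in\{1,\dots,n\}$, $\ell\in\{\mathit{left},\mathit{right}\}$, has the same nodes and parent relation, each node carrying a label (a rotation in its class) and a change index: the root has label its necklace and change index $c$; if a node has label $\alpha$, change index $c'$ and period $p$, with $jp<c'\le jp+p$, its acceptable range is $\{jp+1,\dots,jp+p\}$; a child joined by $(\mathtt{x}\beta,\mathtt{y}\beta)$ gets label $\beta_1\mathtt{y}\beta_2$ and change index $|\beta_1|+1$, where $\alpha=\beta_1\mathtt{x}\beta_2$ is the unique factorization with $\beta_2\beta_1=\beta$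 and $|\beta_1|+1$ in the acceptable range. (Thus the edge joining $\alpha_j$ to its parent is labeled $(\mathtt{y}'\beta_2\beta_1,\mathtt{y}\beta_2\beta_1)$.) Children with change index $<c'$ are left-children, $>c'$ right-children, and $=c'$ left-children if $\ell=\mathit{left}$ (left concatenation tree), right-children if $\ell=\mathit{right}$ (right concatenation tree); each type ordered by increasing change index. RCL order: recursively, the right-children subtrees first to last, then the node, then the left-children subtrees first to last. -}

module Defs where

open import Data.Nat using (ℕ; zero; suc; _+_; _*_; _∸_; _≤_; _<_; _<ᵇ_; _≡ᵇ_)
open import Data.Fin as F using (Fin)
open import Data.Vec as V using (Vec; []; _∷_; _∷ʳ_)
open import Data.List as L using (List; []; _∷_; _++_; length; concat; replicate)
open import Data.List.Properties using (≡-dec)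
open import Data.List.Relation.Unary.All using (All)
open import Data.List.Relation.Unary.AllPairs using (AllPairs)
open import Data.List.Relation.Unary.Any using (Any)
open import Data.List.Relation.Unary.Unique.Propositional using (Unique)
open import Data.Product using (Σ; ∃; _×_; _,_; proj₁; proj₂)
open import Data.Sum using (_⊎_)
open import Data.Bool using (Bool; true; false; _∨_; _∧_; if_then_else_)
open import Relation.Binary.PropositionalEquality using (_≡_; _≢_)
open import Relation.Nullary using (yes; no)
open import Relation.Nullary.Decidable using (⌊_⌋)

-- Which kind of concatenation tree
data Side : Set where
  left right : Side

-- Strings over a finite ordered alphabet Fin k, of length n = suc m.
-- Everything below is parametrised by the alphabet size k and by m = n - 1.

module _ (k m : ℕ) where

  Sym : Set
  Sym = Fin k

  Str : Set
  Str = Vec Sym (suc m)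

  Tail : Set
  Tail = Vec Sym m

  -- A conjugate pair (x β , y β) used as an edge label.
  record Edge : Set where
    constructor edge
    field
      x : Sym
      y : Sym
      β : Tail
  open Edge public

  -- A (concatenation-)tree node: the necklace naming its rotation class,
  -- its concatenation-tree label, its change index, and its children, each
  -- child together with the label of the edge joining it to this node.
  data CTree : Set where
    node : (neck : Str) (lab : Str) (ci : ℕ) (ch : List (Edge × CTree)) → CTree

  neckOf : CTree → Str
  neckOf (node ν _ _ _) = ν

  labOf : CTree → Str
  labOf (node _ α _ _) = α

  ciOf : CTree → ℕ
  ciOf (node _ _ c _) = c

  childrenOf : CTree → List (Edge × CTree)
  childrenOf (node _ _ _ ch) = ch

rot1 : ∀ {A : Set} {m} → Vec A (suc m) → Vec A (suc m)
rot1 (a ∷ as) = as ∷ʳ a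

rot : ∀ {A : Set} {m} → ℕ → Vec A (suc m) → Vec A (suc m)
rot zero    α = α
rot (suc s) α = rot s (rot1 α)

IsRotation : ∀ {A : Set} {m} → Vec A (suc m) → Vec A (suc m) → Set
IsRotation β α = ∃ λ s → rot s α ≡ β

data LexLeq {k} : ∀ {l} → Vec (Fin k) l → Vec (Fin k) l → Set where
  lex-[] : LexLeq [] []
  lex-<  : ∀ {l a b} {as bs : Vec (Fin k) l} → a F.< b → LexLeq (a ∷ as) (b ∷ bs)
  lex-≡  : ∀ {l a} {as bs : Vec (Fin k) l} → LexLeq as bs → LexLeq (a ∷ as) (a ∷ bs)

IsNecklace : ∀ {k m} → Vec (Fin k) (suc m) → Set
IsNecklace α = ∀ s → LexLeq α (rot s α)

IsPowerWithRoot : ∀ {A : Set} {n} → Vec A n → ℕ → Set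
IsPowerWithRoot {A} α p =
  Σ (List A) λ β → Σ ℕ λ q → length β ≡ p × V.toList α ≡ concat (replicate q β)

Period : ∀ {A : Set} {n} → Vec A n → ℕ → Set
Period α p = IsPowerWithRoot α p × (∀ p' → IsPowerWithRoot α p' → p ≤ p')

IsSuffixOf : ∀ {A : Set} → List A → List A → Set
IsSuffixOf {A} s w = Σ (List A) λ pre → w ≡ pre ++ s

module _ {k m : ℕ} where

  mutual
    necks : CTree k m → List (Str k m)
    necks (node ν _ _ ch) = ν ∷ necksL ch

    necksL : List (Edge k m × CTree k m) → List (Str k m)
    necksL [] = []
    necksL ((_ , t) ∷ rest) = necks t L.++ necksL rest

  PCREdge : Str k m → Edge k m × CTree k m → Set
  PCREdge ν (e , t) =
    (x e ≢ y e) × IsRotation (x e ∷ β e) ν × IsRotation (y e ∷ β e) (neckOf k m t)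

  data PCRLocal : CTree k m → Set where
    pcr : ∀ {ν α c ch} → IsNecklace ν →
          All (PCREdge ν) ch →
          All (λ et → PCRLocal (proj₂ et)) ch →
          PCRLocal (node ν α c ch)

  -- PCR-based cycle-joining tree: nodes are distinct rotation classes named
  -- by their necklaces, edges labelled by conjugate pairs as required
  IsPCRTree : CTree k m → Set
  IsPCRTree T = PCRLocal T × Unique (necks T)

  data ChainProperty : CTree k m → Set where
    chainP : ∀ {ν α c ch} →
             AllPairs (λ e₁ e₂ → β (proj₁ e₁) ≢ β (proj₁ e₂)) ch →
             All (λ et → ChainProperty (proj₂ et)) ch →
             ChainProperty (node ν α c ch)

  ChildRule : Str k m → ℕ → Edge k m × CTree k m → Set
  ChildRule α c' (e , t) =
    Σ ℕ λ p → Period α p ×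
    Σ ℕ λ j → (j * p < c' × c' ≤ j * p + p) ×
    Σ (List (Sym k m)) λ β₁ → Σ (List (Sym k m)) λ β₂ →
      V.toList α ≡ β₁ ++ x e ∷ β₂ ×
      β₂ ++ β₁ ≡ V.toList (β e) ×
      (j * p < suc (length β₁) × suc (length β₁) ≤ j * p + p) ×
      V.toList (labOf k m t) ≡ β₁ ++ y e ∷ β₂ ×
      ciOf k m t ≡ suc (length β₁)

  data ConcatBelow : CTree k m → Set where
    cb : ∀ {ν α c ch} →
         All (ChildRule α c) ch →
         AllPairs (λ e₁ e₂ → ciOf k m (proj₂ e₁) < ciOf k m (proj₂ e₂)) ch →
         All (λ et → ConcatBelow (proj₂ et)) ch →
         ConcatBelow (node ν α c ch)

  -- T (with its labels and change indices) is concat(T, c, ℓ); the side ℓ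
  -- only affects the left/right classification used by the RCL order
  IsConcatTree : CTree k m → ℕ → Set
  IsConcatTree T c =
    (1 ≤ c × c ≤ suc m) × labOf k m T ≡ neckOf k m T × ciOf k m T ≡ c × ConcatBelow T

-- RCL order, with for each node its upward context: the list of
-- (edge to parent , parent), (edge from parent to grandparent, grandparent), …

  Up : Set
  Up = List (Edge k m × CTree k m)

  isRight : Side → ℕ → ℕ → Bool
  isRight ℓ c' c'' with c' <ᵇ c'' | c' ≡ᵇ c''
  ... | true  | _     = true
  ... | false | false = false
  ... | false | true  with ℓ
  ...   | left  = false
  ...   | right = true

  mutual
    rcl : Side → Up → CTree k m → List (Up × CTree k m)
    rcl ℓ up t@(node ν α c ch) =
      rights ℓ c t up ch ++ (up , t) ∷ lefts ℓ c t up ch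

    rights : Side → ℕ → CTree k m → Up → List (Edge k m × CTree k m) → List (Up × CTree k m)
    rights ℓ c par up [] = []
    rights ℓ c par up ((e , u) ∷ rest) =
      (if isRight ℓ c (ciOf k m u) then rcl ℓ ((e , par) ∷ up) u else [])
      ++ rights ℓ c par up rest

    lefts : Side → ℕ → CTree k m → Up → List (Edge k m × CTree k m) → List (Up × CTree k m)
    lefts ℓ c par up [] = []
    lefts ℓ c par up ((e , u) ∷ rest) =
      (if isRight ℓ c (ciOf k m u) then [] else rcl ℓ ((e , par) ∷ up) u)
      ++ lefts ℓ c par up rest

  RCL : Side → CTree k m → List (Up × CTree k m)
  RCL ℓ T = rcl ℓ [] T

  -- a is an ancestor of the node (up , t) (a node counts as its own ancestor)
  Ancestor : CTree k m → Up × CTree k m → Set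
  Ancestor a (up , t) = a ≡ t ⊎ Any (λ ep → a ≡ proj₂ ep) up

  -- first(z β) for the string z β (β given as a list) in the node whose upward
  -- context is up: follow the chain upward while the edge into the current node
  -- is (z' β , z β); return the symbol of the topmost node of the chain.
  first : Up → Sym k m → List (Sym k m) → Sym k m
  first [] z bs = z
  first ((e , _) ∷ up) z bs with ≡-dec F._≟_ (V.toList (β e)) bs | y e F.≟ z
  ... | yes _ | yes _ = first up (x e) bs
  ... | _     | _     = z

cpred : ∀ {t} → Fin t → Fin t
cpred {suc t} F.zero    = F.fromℕ t
cpred {suc t} (F.suc i) = F.inject₁ i

{-# OPTIONS --safe #-}
-- The RCL order lists the subtree of a node u as one contiguous block, so it suffices to follow
-- two facts through the recursion. Let u have change index c, label β₁yβ₂ and parent label β₁y′β₂.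
-- (Entry) The node listed just before u's block, unless it lies below u, ends with y′β₂ in a left
-- tree and with first(y′β₂β₁)β₂ in a right tree. (Exit) The last node of u's block agrees with u
-- from position c (left) or c − 1 (right) on. Since the children of u are visited in increasing
-- change index, the exit of one child yields the entry of the next. The claim at u follows from
-- u's entry if u has no right-children, and is vacuous otherwise, as its predecessor then lies
-- below u. In a right tree the chain through a child w of u continues upward only if c_w = c:
-- otherwise the edge into u would put the same symbol at positions c and c_w of u's label, in one
-- period window and followed by the same rotation, and by Lyndon–Schützenberger the label would be
-- a power of a word shorter than its period.
module Submission where

open import Defs
open import Data.Bool using (true; false)
open import Data.Empty using (⊥-elim)
open import Data.Fin using (Fin; zero; suc; fromℕ; inject₁; _≟_)
open import Data.List using (List; []; _∷_; _++_; [_]; _∷ʳ_; length; lookup; take; drop; concat; replicate)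
open import Data.List.Properties
  using (++-assoc; ++-identityʳ; length-++; drop-drop; ∷-injective; ∷-injectiveˡ; ≡-dec; ∷ʳ-++; take++drop≡id)
open import Data.List.Relation.Unary.All using (All; _∷_)
open import Data.List.Relation.Unary.AllPairs using (AllPairs; _∷_)
open import Data.List.Relation.Unary.Any using (Any; here)
open import Data.List.Relation.Unary.Any.Properties using (++⁺ʳ)
open import Data.Nat using (ℕ; zero; suc; _+_; _*_; _∸_; _≤_; _<_; _<ᵇ_; _≡ᵇ_; s≤s; z≤n)
open import Data.Nat.Properties
  using ( ≤-refl; ≤-trans; ≤-pred; ≤-<-trans; <⇒≤; <⇒≢; >⇒≢; ≰⇒>; ≮⇒≥; ≤∧≢⇒<; <-irrefl; <-cmp; _≤?_
        ; m≤m+n; m≤n+m; m+n≤o⇒m≤o; m∸n≤m; m+[n∸m]≡n; +-suc; +-comm; +-identityʳ; +-cancelˡ-<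
        ; +-monoˡ-≤; +-mono-≤; <ᵇ-reflects-<; ≡ᵇ⇒≡; ≡⇒≡ᵇ; module ≤-Reasoning )
  renaming (_≟_ to _≟ℕ_)
open import Data.Product using (Σ; _×_; _,_; proj₁; proj₂)
open import Data.Sum using (_⊎_; inj₁; inj₂)
open import Data.Unit using (⊤; tt)
open import Data.Vec using (Vec; toList)
open import Data.Vec.Properties using (length-toList)
open import Function using (_∘_)
open import Relation.Binary.Definitions using (tri<; tri≈; tri>)
open import Relation.Binary.PropositionalEquality
  using (_≡_; _≢_; refl; sym; trans; cong; cong₂; subst; subst₂; module ≡-Reasoning)
open import Relation.Nullary using (¬_; yes; no)
open import Relation.Nullary.Reflects using (Reflects; ofʸ; ofⁿ; fromEquivalence)

module _ {A : Set} where

  infix 8 _^_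
  _^_ : List A → ℕ → List A
  w ^ n = concat (replicate n w)

  ^-+ : ∀ w i j → w ^ (i + j) ≡ w ^ i ++ w ^ j
  ^-+ w zero    j = refl
  ^-+ w (suc i) j = trans (cong (w ++_) (^-+ w i j)) (sym (++-assoc w (w ^ i) (w ^ j)))

  powers-++ : ∀ w i j {t u} → t ≡ w ^ i → u ≡ w ^ j → t ++ u ≡ w ^ (i + j)
  powers-++ w i j refl refl = sym (^-+ w i j)

  []-^ : ∀ n → [] ^ n ≡ []
  []-^ zero    = refl
  []-^ (suc n) = []-^ n

  ^-rotate : ∀ (a b : List A) n → b ++ (a ++ b) ^ n ++ a ≡ (b ++ a) ^ suc n
  ^-rotate a b zero    = sym (++-identityʳ (b ++ a))
  ^-rotate a b (suc n) = begin
    b ++ ((a ++ b) ++ (a ++ b) ^ n) ++ a  ≡⟨ cong (b ++_) (trans (++-assoc (a ++ b) _ a) (++-assoc a b _)) ⟩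
    b ++ a ++ b ++ (a ++ b) ^ n ++ a      ≡⟨ sym (++-assoc b a _) ⟩
    (b ++ a) ++ b ++ (a ++ b) ^ n ++ a    ≡⟨ cong ((b ++ a) ++_) (^-rotate a b n) ⟩
    (b ++ a) ^ suc (suc n)                ∎
    where open ≡-Reasoning

  rotate-first-symbol : ∀ {a b} z s v n → a ∷ z ++ s ≡ (b ∷ v) ^ suc n → z ++ s ∷ʳ a ≡ (v ∷ʳ b) ^ suc n
  rotate-first-symbol {a} z s v n eq with refl , eq′ ← ∷-injective eq = begin
    z ++ s ++ [ a ]              ≡⟨ sym (++-assoc z s [ a ]) ⟩
    (z ++ s) ++ [ a ]            ≡⟨ cong (_++ [ a ]) eq′ ⟩
    (v ++ (a ∷ v) ^ n) ++ [ a ]  ≡⟨ ++-assoc v _ [ a ] ⟩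
    v ++ (a ∷ v) ^ n ++ [ a ]    ≡⟨ ^-rotate [ a ] v n ⟩
    (v ∷ʳ a) ^ suc n             ∎
    where open ≡-Reasoning

  rotation-of-power : ∀ z s w n → z ++ s ≡ w ^ n →
                      Σ (List A) λ w′ → length w′ ≡ length w × s ++ z ≡ w′ ^ n
  rotation-of-power []      s w       n       eq = w , refl , trans (++-identityʳ s) eq
  rotation-of-power (a ∷ z) s w       zero    ()
  rotation-of-power (a ∷ z) s []      (suc n) eq with () ← trans eq ([]-^ n)
  rotation-of-power (a ∷ z) s (b ∷ v) (suc n) eq
    with w′ , |w′| , eq′ ← rotation-of-power z (s ∷ʳ a) (v ∷ʳ b) (suc n) (rotate-first-symbol z s v n eq) =
    w′ , trans |w′| (trans (length-++ v) (+-comm (length v) 1)) , trans (sym (∷ʳ-++ s a z)) eq′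

  ++-split : ∀ xs {ys} us {vs} → xs ++ ys ≡ us ++ vs → length xs ≤ length us →
             Σ (List A) λ t → us ≡ xs ++ t × ys ≡ t ++ vs
  ++-split []       us       eq _         = us , refl , eq
  ++-split (x ∷ xs) (u ∷ us) eq (s≤s |xs|≤|us|)
    with refl , eq′ ← ∷-injective eq
    with t , us≡ , ys≡ ← ++-split xs us eq′ |xs|≤|us| = t , cong (x ∷_) us≡ , ys≡

  CommonRoot : List A → List A → Set
  CommonRoot t v = Σ (List A) λ w → Σ ℕ λ i → Σ ℕ λ j → t ≡ w ^ i × v ≡ w ^ j

  commonRoot-sym : ∀ {t v} → CommonRoot t v → CommonRoot v t
  commonRoot-sym (w , i , j , t≡ , v≡) = w , j , i , v≡ , t≡

  commonRoot-++ : ∀ {t r} → CommonRoot t r → CommonRoot t (t ++ r)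
  commonRoot-++ (w , i , j , t≡ , r≡) = w , i , i + j , t≡ , powers-++ w i j t≡ r≡

  commuting-suffix : ∀ t v → t ++ v ≡ v ++ t → length t ≤ length v →
                     Σ (List A) λ r → v ≡ t ++ r × t ++ r ≡ r ++ t
  commuting-suffix t v eq |t|≤|v| with r , v≡tr , v≡rt ← ++-split t v eq |t|≤|v| = r , v≡tr , trans (sym v≡tr) v≡rt

  commute⇒commonRoot : ∀ t v → t ++ v ≡ v ++ t → CommonRoot t v
  commute⇒commonRoot t v = go (length t + length v) t v ≤-refl
    where
    go : ∀ n t v → length t + length v ≤ n → t ++ v ≡ v ++ t → CommonRoot t v
    go n [] v _ _ = v , 0 , 1 , refl , sym (++-identityʳ v)
    go n t [] _ _ = t , 1 , 0 , sym (++-identityʳ t) , refl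
    go zero (_ ∷ _) (_ ∷ _) () _
    go (suc n) t@(_ ∷ t′) v@(_ ∷ v′) bound eq with length t ≤? length v
    ... | yes |t|≤|v| with r , v≡tr , comm ← commuting-suffix t v eq |t|≤|v| =
      subst (CommonRoot t) (sym v≡tr) (commonRoot-++ (go n t r (subst (_≤ n) |v|≡ |v|≤n) comm))
      where
      |v|≡ : length v ≡ length t + length r
      |v|≡ = trans (cong length v≡tr) (length-++ t)
      |v|≤n : length v ≤ n
      |v|≤n = ≤-trans (m≤n+m (length v) (length t′)) (≤-pred bound)
    ... | no |t|≰|v| with r , t≡vr , comm ← commuting-suffix v t (sym eq) (<⇒≤ (≰⇒> |t|≰|v|)) =
      subst (λ s → CommonRoot s v) (sym t≡vr) (commonRoot-sym (commonRoot-++ (go n v r (subst (_≤ n) |t|≡ |t|≤n) comm)))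
      where
      |t|≡ : length t ≡ length v + length r
      |t|≡ = trans (cong length t≡vr) (length-++ v)
      |t|≤n : length t ≤ n
      |t|≤n = m+n≤o⇒m≤o (length t) (≤-pred (subst (_≤ suc n) (+-suc (length t) (length v′)) bound))

  root-length-≤ : ∀ {t} w i → t ≡ w ^ i → 0 < length t → length w ≤ length t
  root-length-≤ w zero    refl ()
  root-length-≤ w (suc i) refl _ = subst (length w ≤_) (sym (length-++ w)) (m≤m+n (length w) _)

  conjugate-factors-commute : ∀ {s s′ t L L′ : List A} → s′ ≡ s ++ t → L ≡ t ++ L′ → L ++ s ≡ L′ ++ s′ →
                              t ++ L′ ++ s ≡ (L′ ++ s) ++ t
  conjugate-factors-commute {s} {s′} {t} {L} {L′} s′≡st L≡tL′ eq = begin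
    t ++ L′ ++ s    ≡⟨ sym (++-assoc t L′ s) ⟩
    (t ++ L′) ++ s  ≡⟨ cong (_++ s) (sym L≡tL′) ⟩
    L ++ s          ≡⟨ eq ⟩
    L′ ++ s′        ≡⟨ cong (L′ ++_) s′≡st ⟩
    L′ ++ s ++ t    ≡⟨ sym (++-assoc L′ s t) ⟩
    (L′ ++ s) ++ t  ∎
    where open ≡-Reasoning

  equal-rotations⇒power : ∀ s L s′ L′ → s ++ L ≡ s′ ++ L′ → L ++ s ≡ L′ ++ s′ → length s < length s′ →
                          Σ (List A) λ w → length w + length s ≤ length s′ × Σ ℕ λ n → s ++ L ≡ w ^ n
  equal-rotations⇒power s L s′ L′ eq₁ eq₂ |s|<|s′|
    with t , s′≡st , L≡tL′ ← ++-split s s′ eq₁ (<⇒≤ |s|<|s′|)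
    with w , i , j , t≡ , L′s≡ ← commute⇒commonRoot t (L′ ++ s) (conjugate-factors-commute s′≡st L≡tL′ eq₂)
    with w′ , |w′|≡ , sL≡ ← rotation-of-power L s w (i + j)
                              (trans (cong (_++ s) L≡tL′) (trans (++-assoc t L′ s) (powers-++ w i j t≡ L′s≡)))
    = w′ , |w′|+|s|≤|s′| , i + j , sL≡
    where
    |s′|≡ : length s′ ≡ length s + length t
    |s′|≡ = trans (cong length s′≡st) (length-++ s)
    |w|≤|t| : length w ≤ length t
    |w|≤|t| = root-length-≤ w i t≡ (+-cancelˡ-< (length s) 0 (length t)
                (subst₂ _<_ (sym (+-identityʳ (length s))) |s′|≡ |s|<|s′|))
    |w′|+|s|≤|s′| : length w′ + length s ≤ length s′
    |w′|+|s|≤|s′| = subst₂ _≤_ (cong (_+ length s) (sym |w′|≡)) (trans (+-comm (length t) (length s)) (sym |s′|≡))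
                      (+-monoˡ-≤ (length s) |w|≤|t|)

InWindow : ℕ → ℕ → ℕ → Set
InWindow p j i = j * p < i × i ≤ j * p + p

module _ {A : Set} {n} {α : Vec A n} {p j : ℕ} (per : Period α p) where

  private
    no-shift-within-period : ∀ b₁ b₂ b₁′ b₂′ {a} → toList α ≡ b₁ ++ a ∷ b₂ → toList α ≡ b₁′ ++ a ∷ b₂′ →
                             b₂ ++ b₁ ≡ b₂′ ++ b₁′ → InWindow p j (suc (length b₁)) →
                             InWindow p j (suc (length b₁′)) → ¬ length b₁ < length b₁′
    no-shift-within-period b₁ b₂ b₁′ b₂′ {a} α≡ α≡′ rot≡ (jp<|b₁|+1 , _) (_ , |b₁′|+1≤jp+p) |b₁|<|b₁′|
      with w , |w|+|b₁|≤|b₁′| , k , power ←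
             equal-rotations⇒power b₁ (a ∷ b₂) b₁′ (a ∷ b₂′) (trans (sym α≡) α≡′) (cong (a ∷_) rot≡) |b₁|<|b₁′|
      = <-irrefl refl (begin-strict
          length b₁′                 <⟨ |b₁′|+1≤jp+p ⟩
          j * p + p                  ≤⟨ +-mono-≤ (≤-pred jp<|b₁|+1) p≤|w| ⟩
          length b₁ + length w       ≡⟨ +-comm (length b₁) (length w) ⟩
          length w + length b₁       ≤⟨ |w|+|b₁|≤|b₁′| ⟩
          length b₁′                 ∎)
      where
      open ≤-Reasoning
      p≤|w| : p ≤ length w
      p≤|w| = proj₂ per (length w) (w , k , refl , trans α≡ power)

  period-position-unique : ∀ b₁ b₂ b₁′ b₂′ {a} → toList α ≡ b₁ ++ a ∷ b₂ → toList α ≡ b₁′ ++ a ∷ b₂′ →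
                           b₂ ++ b₁ ≡ b₂′ ++ b₁′ → InWindow p j (suc (length b₁)) →
                           InWindow p j (suc (length b₁′)) → length b₁ ≡ length b₁′
  period-position-unique b₁ b₂ b₁′ b₂′ α≡ α≡′ rot≡ win win′ with <-cmp (length b₁) (length b₁′)
  ... | tri< lt _ _ = ⊥-elim (no-shift-within-period b₁ b₂ b₁′ b₂′ α≡ α≡′ rot≡ win win′ lt)
  ... | tri≈ _ eq _ = eq
  ... | tri> _ _ gt = ⊥-elim (no-shift-within-period b₁′ b₂′ b₁ b₂ α≡′ α≡ (sym rot≡) win′ win gt)

module _ {A : Set} where

  take-length-++ : ∀ (b : List A) r → take (length b) (b ++ r) ≡ b
  take-length-++ []      r = refl
  take-length-++ (x ∷ b) r = cong (x ∷_) (take-length-++ b r)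

  drop-length-++ : ∀ (b : List A) r → drop (length b) (b ++ r) ≡ r
  drop-length-++ []      r = refl
  drop-length-++ (x ∷ b) r = drop-length-++ b r

  drop-suc-∷ : ∀ n (l : List A) {a r} → drop n l ≡ a ∷ r → drop (suc n) l ≡ r
  drop-suc-∷ zero    (x ∷ l) refl = refl
  drop-suc-∷ (suc n) (x ∷ l) eq   = drop-suc-∷ n l eq

  drop-pred-∷ : ∀ {c} (l : List A) {a r} → 1 ≤ c → drop (c ∸ 1) l ≡ a ∷ r → drop c l ≡ r
  drop-pred-∷ {suc c} l _ = drop-suc-∷ c l

  drop-pred : ∀ c (l : List A) → 1 ≤ c → c ≤ length l → Σ A λ a → drop (c ∸ 1) l ≡ a ∷ drop c l
  drop-pred (suc zero)    (x ∷ l) _ _         = x , refl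
  drop-pred (suc (suc c)) (x ∷ l) _ (s≤s c≤l) = drop-pred (suc c) l (s≤s z≤n) c≤l

  -- positions are counted from 1, as in the paper
  split-at-position : ∀ {L b₁ : List A} {a b₂ i} → L ≡ b₁ ++ a ∷ b₂ → i ≡ suc (length b₁) →
                      take (i ∸ 1) L ≡ b₁ × drop i L ≡ b₂ × drop (i ∸ 1) L ≡ a ∷ b₂
  split-at-position {b₁ = b₁} {a} {b₂} refl refl =
    take-length-++ b₁ (a ∷ b₂) ,
    drop-suc-∷ (length b₁) (b₁ ++ a ∷ b₂) (drop-length-++ b₁ (a ∷ b₂)) ,
    drop-length-++ b₁ (a ∷ b₂)

  drop-≡-mono : ∀ {i i′} (xs ys : List A) → i ≤ i′ → drop i xs ≡ drop i ys → drop i′ xs ≡ drop i′ ys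
  drop-≡-mono {i} {i′} xs ys i≤i′ eq = begin
    drop i′ xs                ≡⟨ cong (λ n → drop n xs) (sym (m+[n∸m]≡n i≤i′)) ⟩
    drop (i + (i′ ∸ i)) xs    ≡⟨ sym (drop-drop i (i′ ∸ i) xs) ⟩
    drop (i′ ∸ i) (drop i xs) ≡⟨ cong (drop (i′ ∸ i)) eq ⟩
    drop (i′ ∸ i) (drop i ys) ≡⟨ drop-drop i (i′ ∸ i) ys ⟩
    drop (i + (i′ ∸ i)) ys    ≡⟨ cong (λ n → drop n ys) (m+[n∸m]≡n i≤i′) ⟩
    drop i′ ys                ∎
    where open ≡-Reasoning

  drop⇒IsSuffixOf : ∀ n (l : List A) {s} → drop n l ≡ s → IsSuffixOf s l
  drop⇒IsSuffixOf n l eq = take n l , trans (sym (take++drop≡id n l)) (cong (take n l ++_) eq)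

module _ {X : Set} where

  LinkedFrom : (X → X → Set) → X → List X → Set
  LinkedFrom R q []       = ⊤
  LinkedFrom R q (x ∷ xs) = R q x × LinkedFrom R x xs

  lastFrom : X → List X → X
  lastFrom q []       = q
  lastFrom q (x ∷ xs) = lastFrom x xs

  lastFrom-++ : ∀ q (xs ys : List X) → lastFrom q (xs ++ ys) ≡ lastFrom (lastFrom q xs) ys
  lastFrom-++ q []       ys = refl
  lastFrom-++ q (x ∷ xs) ys = lastFrom-++ x xs ys

  LinkedFrom-++ : ∀ {R} q (xs ys : List X) → LinkedFrom R q xs → LinkedFrom R (lastFrom q xs) ys →
                  LinkedFrom R q (xs ++ ys)
  LinkedFrom-++ q []       ys _          linked = linked
  LinkedFrom-++ q (x ∷ xs) ys (r , rest) linked = r , LinkedFrom-++ x xs ys rest linked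

  lookup-last : ∀ (b : X) bs → lookup (b ∷ bs) (fromℕ (length bs)) ≡ lastFrom b bs
  lookup-last b []       = refl
  lookup-last b (c ∷ cs) = lookup-last c cs

  LinkedFrom-lookup : ∀ {R} (b : X) bs → LinkedFrom R b bs → (j : Fin (length bs)) →
                      R (lookup (b ∷ bs) (inject₁ j)) (lookup bs j)
  LinkedFrom-lookup b (c ∷ cs) (r , _)      zero    = r
  LinkedFrom-lookup b (c ∷ cs) (_ , linked) (suc j) = LinkedFrom-lookup c cs linked j

  LinkedFrom-cyclic : ∀ {R} (B : List X) q → LinkedFrom R (lastFrom q B) B → (j : Fin (length B)) →
                      R (lookup B (cpred j)) (lookup B j)
  LinkedFrom-cyclic {R} (b ∷ bs) q (r , _)      zero    = subst (λ z → R z b) (sym (lookup-last b bs)) r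
  LinkedFrom-cyclic     (b ∷ bs) q (_ , linked) (suc j) = LinkedFrom-lookup b bs linked j

≡ᵇ-reflects-≡ : ∀ m n → Reflects (m ≡ n) (m ≡ᵇ n)
≡ᵇ-reflects-≡ m n = fromEquivalence (≡ᵇ⇒≡ m n) (≡⇒≡ᵇ m n)

<⇒≤∸1 : ∀ {i c} → i < c → i ≤ c ∸ 1
<⇒≤∸1 (s≤s i≤c) = i≤c

module _ (k m : ℕ) where

  Tree : Set
  Tree = CTree k m

  Node : Set
  Node = Up {k} {m} × Tree

  lab : Tree → List (Sym k m)
  lab t = toList (labOf k m t)

  labN : Node → List (Sym k m)
  labN q = lab (proj₂ q)

  ci : Tree → ℕ
  ci = ciOf k m

  prefixOf suffixOf : Tree → List (Sym k m)
  prefixOf u = take (ci u ∸ 1) (lab u)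
  suffixOf u = drop (ci u) (lab u)

  Joined : Tree → Edge k m × Tree → Set
  Joined u = ChildRule (labOf k m u) (ci u)

  ParentRule : Up {k} {m} → Tree → Set
  ParentRule []            u = 1 ≤ ci u × ci u ≤ suc m
  ParentRule ((e , G) ∷ _) u = Joined G (e , u)

  AgreesFrom : ℕ → Node → Tree → Set
  AgreesFrom i q u = drop i (labN q) ≡ drop i (lab u)

  StrictAncestor : Tree → Node → Set
  StrictAncestor u q = Any (λ ep → u ≡ proj₂ ep) (proj₁ q)

  record Splitting (u : Tree) (e : Edge k m) (w : Tree) : Set where
    field
      parent-label : lab u ≡ prefixOf w ++ x e ∷ suffixOf w
      parent-at    : drop (ci w ∸ 1) (lab u) ≡ x e ∷ suffixOf w
      child-at     : drop (ci w ∸ 1) (lab w) ≡ y e ∷ suffixOf w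
      same-prefix  : take (ci w ∸ 1) (lab u) ≡ prefixOf w
      same-suffix  : drop (ci w) (lab u) ≡ suffixOf w
      tail-β       : toList (β e) ≡ suffixOf w ++ prefixOf w

  splitting : ∀ {u e w} → Joined u (e , w) → Splitting u e w
  splitting {u} {e} {w} (_ , _ , _ , _ , b₁ , b₂ , u≡ , β≡ , _ , w≡ , ci≡)
    with pre-u , suf-u , at-u ← split-at-position u≡ ci≡
       | pre-w , suf-w , at-w ← split-at-position w≡ ci≡ = record
    { parent-label = trans u≡ (cong₂ (λ s t → s ++ x e ∷ t) (sym pre-w) (sym suf-w))
    ; parent-at    = trans at-u (cong (x e ∷_) (sym suf-w))
    ; child-at     = trans at-w (cong (y e ∷_) (sym suf-w))
    ; same-prefix  = trans pre-u (sym pre-w)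
    ; same-suffix  = trans suf-u (sym suf-w)
    ; tail-β       = trans (sym β≡) (cong₂ _++_ (sym suf-w) (sym pre-w))
    }

  first-step : ∀ (e : Edge k m) G rest {bs} → toList (β e) ≡ bs →
               first ((e , G) ∷ rest) (y e) bs ≡ first rest (x e) bs
  first-step e G rest {bs} β≡bs with ≡-dec _≟_ (toList (β e)) bs | y e ≟ y e
  ... | yes _   | yes _   = refl
  ... | no β≢bs | _       = ⊥-elim (β≢bs β≡bs)
  ... | yes _   | no y≢y  = ⊥-elim (y≢y refl)

  first-of-child : ∀ up u e w {a} → Joined u (e , w) → drop (ci w ∸ 1) (lab w) ≡ a ∷ suffixOf w →
                   first ((e , u) ∷ up) a (suffixOf w ++ prefixOf w) ≡ first up (x e) (suffixOf w ++ prefixOf w)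
  first-of-child up u e w joined at =
    trans (cong (λ b → first ((e , u) ∷ up) b _) (∷-injectiveˡ (trans (sym at) child-at)))
          (first-step e u up tail-β)
    where open Splitting (splitting {u} {e} {w} joined)

  first-off-chain : ∀ up u {e w} → ParentRule up u → Joined u (e , w) → ci w ≢ ci u →
                    first up (x e) (toList (β e)) ≡ x e
  first-off-chain []              u _ _ _ = refl
  first-off-chain ((e′ , G) ∷ up) u {e} {w}
                  (_ , _ , _ , _ , c₁ , c₂ , _ , β′≡ , _ , u≡′ , ci-u≡)
                  (p , per , j , win-u , b₁ , b₂ , u≡ , β≡ , win-w , _ , ci-w≡) ci-w≢ci-u
    with ≡-dec _≟_ (toList (β e′)) (toList (β e)) | y e′ ≟ x e
  ... | yes β′≡β | yes y′≡x = ⊥-elim (ci-w≢ci-u (trans ci-w≡ (trans (cong suc same-position) (sym ci-u≡))))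
    where
    same-position : length b₁ ≡ length c₁
    same-position = period-position-unique {j = j} per b₁ b₂ c₁ c₂ u≡ (subst (λ a → lab u ≡ c₁ ++ a ∷ c₂) y′≡x u≡′)
                      (trans β≡ (trans (sym β′≡β) (sym β′≡))) win-w (subst (InWindow p j) ci-u≡ win-u)
  ... | yes _ | no _ = refl
  ... | no _  | _    = refl

  SuffixProperty : Side → Node → Node → Set
  SuffixProperty ℓ q n = ¬ Ancestor u q →
    Σ (Edge k m) λ e → Σ Tree λ P → Σ (Up {k} {m}) λ rest → proj₁ n ≡ (e , P) ∷ rest ×
    Σ (Sym k m) λ y′ → lab P ≡ prefixOf u ++ y′ ∷ suffixOf u ×
      (ℓ ≡ left → IsSuffixOf (y′ ∷ suffixOf u) (labN q)) ×
      (ℓ ≡ right → IsSuffixOf (first rest y′ (suffixOf u ++ prefixOf u) ∷ suffixOf u) (labN q))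
    where u = proj₂ n

  -- q is the node listed just before the first node of the RCL order of the subtree at u
  EntrySuffix : Side → Up {k} {m} → Tree → Node → Set
  EntrySuffix left  []            u q = AgreesFrom (ci u) q u
  EntrySuffix left  ((_ , G) ∷ _) u q = AgreesFrom (ci u ∸ 1) q G
  EntrySuffix right up            u q = ∀ a → drop (ci u ∸ 1) (lab u) ≡ a ∷ suffixOf u →
    drop (ci u ∸ 1) (labN q) ≡ first up a (suffixOf u ++ prefixOf u) ∷ suffixOf u

  Entry : Side → Up {k} {m} → Tree → Node → Set
  Entry ℓ up u q = (up ≡ [] → Ancestor u q) × EntrySuffix ℓ up u q

  entry⇒suffixProperty : ∀ ℓ up u q → ParentRule up u → Entry ℓ up u q → SuffixProperty ℓ q (up , u)
  entry⇒suffixProperty ℓ [] u q _ (root-ancestor , _) not-ancestor = ⊥-elim (not-ancestor (root-ancestor refl))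
  entry⇒suffixProperty left ((e , G) ∷ rest) u q joined (_ , agrees) _ =
    e , G , rest , refl , x e , parent-label ,
    (λ _ → drop⇒IsSuffixOf (ci u ∸ 1) (labN q) (trans agrees parent-at)) , λ ()
    where open Splitting (splitting {G} {e} {u} joined)
  entry⇒suffixProperty right ((e , G) ∷ rest) u q joined (_ , entry) _ =
    e , G , rest , refl , x e , parent-label , (λ ()) ,
    λ _ → drop⇒IsSuffixOf (ci u ∸ 1) (labN q)
            (trans (entry (y e) child-at) (cong (_∷ suffixOf u) (first-step e G rest tail-β)))
    where open Splitting (splitting {G} {e} {u} joined)

  ParentRule⇒1≤ci : ∀ up u → ParentRule up u → 1 ≤ ci u
  ParentRule⇒1≤ci []      u (1≤ci , _) = 1≤ci
  ParentRule⇒1≤ci (_ ∷ _) u (_ , _ , _ , _ , _ , _ , _ , _ , _ , _ , ci≡) = subst (1 ≤_) (sym ci≡) (s≤s z≤n)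

  symbol-at-change : ∀ up u → ParentRule up u → Σ (Sym k m) λ a → drop (ci u ∸ 1) (lab u) ≡ a ∷ suffixOf u
  symbol-at-change []            u (1≤ci , ci≤n) =
    drop-pred (ci u) (lab u) 1≤ci (subst (ci u ≤_) (sym (length-toList (labOf k m u))) ci≤n)
  symbol-at-change ((e , G) ∷ _) u joined = y e , Splitting.child-at (splitting {G} {e} {u} joined)

  entry⇒agreesFrom : ∀ ℓ up u q → ParentRule up u → Entry ℓ up u q → AgreesFrom (ci u) q u
  entry⇒agreesFrom left  []            u q _      (_ , agrees) = agrees
  entry⇒agreesFrom left  ((e , G) ∷ _) u q joined (_ , agrees) =
    trans (drop-≡-mono (labN q) (lab G) (m∸n≤m (ci u) 1) agrees) (Splitting.same-suffix (splitting {G} {e} {u} joined))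
  entry⇒agreesFrom right up u q rule (_ , entry) with a , at ← symbol-at-change up u rule =
    drop-pred-∷ (labN q) (ParentRule⇒1≤ci up u rule) (entry a at)

  right-entry-of-child : ∀ up u e w q → Joined u (e , w) →
                         drop (ci w ∸ 1) (labN q) ≡ first up (x e) (suffixOf w ++ prefixOf w) ∷ suffixOf w →
                         Entry right ((e , u) ∷ up) w q
  right-entry-of-child up u e w q joined eq =
    (λ ()) , λ a at → trans eq (cong (_∷ suffixOf w) (sym (first-of-child up u e w joined at)))

  entry-of-child : ∀ ℓ up u e w q → ParentRule up u → Joined u (e , w) → AgreesFrom (ci w ∸ 1) q u →
                   (ℓ ≡ right → ci w ≢ ci u) → Entry ℓ ((e , u) ∷ up) w q
  entry-of-child left  up u e w q _    _      agrees _   = (λ ()) , agrees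
  entry-of-child right up u e w q rule joined agrees ci≢ = right-entry-of-child up u e w q joined (begin
    drop (ci w ∸ 1) (labN q)                         ≡⟨ agrees ⟩
    drop (ci w ∸ 1) (lab u)                          ≡⟨ parent-at ⟩
    x e ∷ suffixOf w                                 ≡⟨ cong (_∷ suffixOf w) (sym first≡x) ⟩
    first up (x e) (suffixOf w ++ prefixOf w) ∷ suffixOf w  ∎)
    where
    open ≡-Reasoning
    open Splitting (splitting {u} {e} {w} joined)
    first≡x : first up (x e) (suffixOf w ++ prefixOf w) ≡ x e
    first≡x = trans (cong (first up (x e)) (sym tail-β)) (first-off-chain up u {e} {w} rule joined (ci≢ refl))

  entry-along-chain : ∀ up u e w q → Joined u (e , w) → ci w ≡ ci u → EntrySuffix right up u q →
                      Entry right ((e , u) ∷ up) w q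
  entry-along-chain up u e w q joined w≡u entry = right-entry-of-child up u e w q joined (begin
    drop (ci w ∸ 1) (labN q)                                ≡⟨ cong (λ c → drop (c ∸ 1) (labN q)) w≡u ⟩
    drop (ci u ∸ 1) (labN q)                                ≡⟨ entry (x e) at-u ⟩
    first up (x e) (suffixOf u ++ prefixOf u) ∷ suffixOf u  ≡⟨ cong₂ (λ s t → first up (x e) (s ++ t) ∷ s) suf≡ pre≡ ⟩
    first up (x e) (suffixOf w ++ prefixOf w) ∷ suffixOf w  ∎)
    where
    open ≡-Reasoning
    open Splitting (splitting {u} {e} {w} joined)
    pre≡ : prefixOf u ≡ prefixOf w
    pre≡ = trans (cong (λ c → take (c ∸ 1) (lab u)) (sym w≡u)) same-prefix
    suf≡ : suffixOf u ≡ suffixOf w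
    suf≡ = trans (cong (λ c → drop c (lab u)) (sym w≡u)) same-suffix
    at-u : drop (ci u ∸ 1) (lab u) ≡ x e ∷ suffixOf u
    at-u = trans (cong (λ c → drop (c ∸ 1) (lab u)) (sym w≡u)) (trans parent-at (cong (x e ∷_) (sym suf≡)))

  RightOf LeftOf : Side → ℕ → ℕ → Set
  RightOf left  c i = c < i
  RightOf right c i = c ≤ i
  LeftOf  left  c i = i ≤ c
  LeftOf  right c i = i < c

  isRight-reflects : ∀ ℓ c i → Reflects (RightOf ℓ c i) (isRight {k} {m} ℓ c i)
  isRight-reflects ℓ c i with c <ᵇ i | <ᵇ-reflects-< c i | c ≡ᵇ i | ≡ᵇ-reflects-≡ c i
  isRight-reflects left  c i | true  | ofʸ c<i | _     | _          = ofʸ c<i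
  isRight-reflects right c i | true  | ofʸ c<i | _     | _          = ofʸ (<⇒≤ c<i)
  isRight-reflects left  c i | false | ofⁿ c≮i | false | _          = ofⁿ c≮i
  isRight-reflects left  c i | false | ofⁿ c≮i | true  | _          = ofⁿ c≮i
  isRight-reflects right c i | false | ofⁿ c≮i | false | ofⁿ c≢i   = ofⁿ (λ c≤i → c≮i (≤∧≢⇒< c≤i c≢i))
  isRight-reflects right c i | false | ofⁿ _   | true  | ofʸ refl   = ofʸ ≤-refl

  ¬RightOf⇒LeftOf : ∀ ℓ {c i} → ¬ RightOf ℓ c i → LeftOf ℓ c i
  ¬RightOf⇒LeftOf left  = ≮⇒≥
  ¬RightOf⇒LeftOf right = ≰⇒>

  RightOf⇒≤ : ∀ ℓ {c i} → RightOf ℓ c i → c ≤ i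
  RightOf⇒≤ left  = <⇒≤
  RightOf⇒≤ right c≤i = c≤i

  LeftOf⇒≢ : ∀ ℓ {c i} → LeftOf ℓ c i → ℓ ≡ right → i ≢ c
  LeftOf⇒≢ right i<c refl = <⇒≢ i<c

  exitIndex : Side → ℕ → ℕ
  exitIndex left  c = c
  exitIndex right c = c ∸ 1

  LeftOf⇒≤exitIndex : ∀ ℓ {c i} → LeftOf ℓ c i → i ≤ exitIndex ℓ c
  LeftOf⇒≤exitIndex left  i≤c = i≤c
  LeftOf⇒≤exitIndex right i<c = <⇒≤∸1 i<c

  exitIndex-≤ : ∀ ℓ c → exitIndex ℓ c ≤ c
  exitIndex-≤ left  c = ≤-refl
  exitIndex-≤ right c = m∸n≤m c 1

  -- z is the last node of the RCL order of the subtree at u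
  Exit : Side → Up {k} {m} → Tree → Node → Set
  Exit ℓ up u z = AgreesFrom (exitIndex ℓ (ci u)) z u × Ancestor u z × IsSuffixOf up (proj₁ z)

  exit⇒root-entry : ∀ ℓ u z → Exit ℓ [] u z → Entry ℓ [] u z
  exit⇒root-entry left  u z (agrees , ancestor , _) = (λ _ → ancestor) , agrees
  exit⇒root-entry right u z (agrees , ancestor , _) = (λ _ → ancestor) , λ a at → trans agrees at

  exit⇒agreesWithParent : ∀ ℓ u e w z → Joined u (e , w) → AgreesFrom (exitIndex ℓ (ci w)) z w → AgreesFrom (ci w) z u
  exit⇒agreesWithParent ℓ u e w z joined agrees =
    trans (drop-≡-mono (labN z) (lab w) (exitIndex-≤ ℓ (ci w)) agrees) (sym (Splitting.same-suffix (splitting {u} {e} {w} joined)))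

  path⇒strictAncestor : ∀ e u up (z : Node) → IsSuffixOf ((e , u) ∷ up) (proj₁ z) → StrictAncestor u z
  path⇒strictAncestor e u up z (pre , z≡) = subst (Any (λ ep → u ≡ proj₂ ep)) (sym z≡) (++⁺ʳ pre (here refl))

  path-tail : ∀ {A : Set} {a : A} {xs zs} → IsSuffixOf (a ∷ xs) zs → IsSuffixOf xs zs
  path-tail {a = a} {xs} (pre , zs≡) = pre ∷ʳ a , trans zs≡ (sym (∷ʳ-++ pre a xs))

  -- q ends the subtree of an already visited child of u with change index i
  AfterSibling : (ℕ → ℕ → Set) → Tree → Node → List (Edge k m × Tree) → Set
  AfterSibling Rel u q ch = Σ ℕ λ i → Rel (ci u) i × AgreesFrom i q u × All (λ et → i < ci (proj₂ et)) ch

  RightScan : Side → Up {k} {m} → Tree → Node → List (Edge k m × Tree) → Set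
  RightScan ℓ up u q ch = Entry ℓ up u q ⊎ (StrictAncestor u q × AfterSibling (RightOf ℓ) u q ch)

  LeftScan : Side → Up {k} {m} → Tree → Node → List (Edge k m × Tree) → Set
  LeftScan ℓ up u q ch =
    q ≡ (up , u) ⊎ (StrictAncestor u q × IsSuffixOf up (proj₁ q) × AfterSibling (LeftOf ℓ) u q ch)

  rightScan-tail : ∀ {ℓ up u q et ch} → RightScan ℓ up u q (et ∷ ch) → RightScan ℓ up u q ch
  rightScan-tail (inj₁ entry)          = inj₁ entry
  rightScan-tail (inj₂ (below , i , rel , agrees , _ ∷ later)) = inj₂ (below , i , rel , agrees , later)

  leftScan-tail : ∀ {ℓ up u q et ch} → LeftScan ℓ up u q (et ∷ ch) → LeftScan ℓ up u q ch
  leftScan-tail (inj₁ q≡u)                    = inj₁ q≡u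
  leftScan-tail (inj₂ (below , path , i , rel , agrees , _ ∷ later)) = inj₂ (below , path , i , rel , agrees , later)

  rightScan⇒suffixProperty : ∀ ℓ up u z → ParentRule up u → RightScan ℓ up u z [] → SuffixProperty ℓ z (up , u)
  rightScan⇒suffixProperty ℓ up u z rule (inj₁ entry)     = entry⇒suffixProperty ℓ up u z rule entry
  rightScan⇒suffixProperty ℓ up u z rule (inj₂ (below , _)) not-ancestor = ⊥-elim (not-ancestor (inj₂ below))

  leftScan⇒exit : ∀ ℓ up u q → LeftScan ℓ up u q [] → Exit ℓ up u q
  leftScan⇒exit ℓ up u .(up , u) (inj₁ refl) = refl , inj₁ refl , [] , refl
  leftScan⇒exit ℓ up u q (inj₂ (below , path , i , i≤u , agrees , _)) =
    drop-≡-mono (labN q) (lab u) (LeftOf⇒≤exitIndex ℓ i≤u) agrees , inj₂ below , path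

  entry-of-right-child : ∀ ℓ up u e w q rest → ParentRule up u → Joined u (e , w) → RightOf ℓ (ci u) (ci w) →
                         RightScan ℓ up u q ((e , w) ∷ rest) → Entry ℓ ((e , u) ∷ up) w q
  entry-of-right-child left up u e w q _ rule joined u<w (inj₁ entry) =
    entry-of-child left up u e w q rule joined
      (drop-≡-mono (labN q) (lab u) (<⇒≤∸1 u<w) (entry⇒agreesFrom left up u q rule entry)) λ ()
  entry-of-right-child right up u e w q _ rule joined u≤w (inj₁ entry) with ci w ≟ℕ ci u
  ... | yes w≡u = entry-along-chain up u e w q joined w≡u (proj₂ entry)
  ... | no  w≢u = entry-of-child right up u e w q rule joined
      (drop-≡-mono (labN q) (lab u) (<⇒≤∸1 (≤∧≢⇒< u≤w (w≢u ∘ sym))) (entry⇒agreesFrom right up u q rule entry))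
      λ _ → w≢u
  entry-of-right-child ℓ up u e w q _ rule joined _ (inj₂ (_ , i , u≤i , agrees , i<w ∷ _)) =
    entry-of-child ℓ up u e w q rule joined (drop-≡-mono (labN q) (lab u) (<⇒≤∸1 i<w) agrees)
      λ _ → >⇒≢ (≤-<-trans (RightOf⇒≤ ℓ u≤i) i<w)

  entry-of-left-child : ∀ ℓ up u e w q rest → ParentRule up u → Joined u (e , w) → LeftOf ℓ (ci u) (ci w) →
                        LeftScan ℓ up u q ((e , w) ∷ rest) → Entry ℓ ((e , u) ∷ up) w q
  entry-of-left-child ℓ up u e w .(up , u) _ rule joined w≤u (inj₁ refl) =
    entry-of-child ℓ up u e w (up , u) rule joined refl (LeftOf⇒≢ ℓ w≤u)
  entry-of-left-child ℓ up u e w q _ rule joined w≤u (inj₂ (_ , _ , i , _ , agrees , i<w ∷ _)) =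
    entry-of-child ℓ up u e w q rule joined (drop-≡-mono (labN q) (lab u) (<⇒≤∸1 i<w) agrees) (LeftOf⇒≢ ℓ w≤u)

  Block : Side → Up {k} {m} → Tree → Set
  Block ℓ up u = ∀ q → (Entry ℓ up u q → LinkedFrom (SuffixProperty ℓ) q (rcl ℓ up u)) ×
                       Exit ℓ up u (lastFrom q (rcl ℓ up u))

  Increasing : List (Edge k m × Tree) → Set
  Increasing = AllPairs (λ e₁ e₂ → ci (proj₂ e₁) < ci (proj₂ e₂))

  mutual
    block : ∀ ℓ up u → ParentRule up u → ConcatBelow u → Block ℓ up u
    block ℓ up u@(node _ _ c ch) rule (cb joins increasing belows) q = linked , exit
      where
      Rs = rights ℓ c u up ch
      Ls = lefts ℓ c u up ch
      left-part = lefts-linked ℓ up u ch rule joins increasing belows (up , u) (inj₁ refl)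
      exit : Exit ℓ up u (lastFrom q (rcl ℓ up u))
      exit = subst (Exit ℓ up u) (sym (lastFrom-++ q Rs ((up , u) ∷ Ls))) (proj₂ left-part)
      linked : Entry ℓ up u q → LinkedFrom (SuffixProperty ℓ) q (rcl ℓ up u)
      linked entry = LinkedFrom-++ q Rs ((up , u) ∷ Ls) (proj₁ right-part)
                       (rightScan⇒suffixProperty ℓ up u _ rule (proj₂ right-part) , proj₁ left-part)
        where right-part = rights-linked ℓ up u ch rule joins increasing belows q (inj₁ entry)

    rights-linked : ∀ ℓ up u ch → ParentRule up u → All (Joined u) ch → Increasing ch →
                    All (λ et → ConcatBelow (proj₂ et)) ch → ∀ q → RightScan ℓ up u q ch →
                    LinkedFrom (SuffixProperty ℓ) q (rights ℓ (ci u) u up ch) ×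
                    RightScan ℓ up u (lastFrom q (rights ℓ (ci u) u up ch)) []
    rights-linked ℓ up u [] _ _ _ _ q scan = tt , scan
    rights-linked ℓ up u ((e , w) ∷ rest) rule (joined ∷ joins) (w<rest ∷ increasing) (below ∷ belows) q scan
      with isRight {k} {m} ℓ (ci u) (ci w) | isRight-reflects ℓ (ci u) (ci w)
    ... | false | ofⁿ _ = rights-linked ℓ up u rest rule joins increasing belows q (rightScan-tail scan)
    ... | true  | ofʸ u≤w =
      LinkedFrom-++ q Bw Rs (proj₁ (block-w q) entry-w) (proj₁ after) ,
      subst (λ z → RightScan ℓ up u z []) (sym (lastFrom-++ q Bw Rs)) (proj₂ after)
      where
      Bw = rcl ℓ ((e , u) ∷ up) w
      Rs = rights ℓ (ci u) u up rest
      block-w = block ℓ ((e , u) ∷ up) w joined below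
      entry-w = entry-of-right-child ℓ up u e w q rest rule joined u≤w scan
      z = lastFrom q Bw
      exit-w = proj₂ (block-w q)
      after = rights-linked ℓ up u rest rule joins increasing belows z
                (inj₂ (path⇒strictAncestor e u up z (proj₂ (proj₂ exit-w)) ,
                       ci w , u≤w , exit⇒agreesWithParent ℓ u e w z joined (proj₁ exit-w) , w<rest))

    lefts-linked : ∀ ℓ up u ch → ParentRule up u → All (Joined u) ch → Increasing ch →
                   All (λ et → ConcatBelow (proj₂ et)) ch → ∀ q → LeftScan ℓ up u q ch →
                   LinkedFrom (SuffixProperty ℓ) q (lefts ℓ (ci u) u up ch) ×
                   Exit ℓ up u (lastFrom q (lefts ℓ (ci u) u up ch))
    lefts-linked ℓ up u [] _ _ _ _ q scan = tt , leftScan⇒exit ℓ up u q scan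
    lefts-linked ℓ up u ((e , w) ∷ rest) rule (joined ∷ joins) (w<rest ∷ increasing) (below ∷ belows) q scan
      with isRight {k} {m} ℓ (ci u) (ci w) | isRight-reflects ℓ (ci u) (ci w)
    ... | true  | ofʸ _ = lefts-linked ℓ up u rest rule joins increasing belows q (leftScan-tail scan)
    ... | false | ofⁿ u≰w =
      LinkedFrom-++ q Bw Ls (proj₁ (block-w q) entry-w) (proj₁ after) ,
      subst (Exit ℓ up u) (sym (lastFrom-++ q Bw Ls)) (proj₂ after)
      where
      w≤u = ¬RightOf⇒LeftOf ℓ u≰w
      Bw = rcl ℓ ((e , u) ∷ up) w
      Ls = lefts ℓ (ci u) u up rest
      block-w = block ℓ ((e , u) ∷ up) w joined below
      entry-w = entry-of-left-child ℓ up u e w q rest rule joined w≤u scan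
      z = lastFrom q Bw
      exit-w = proj₂ (block-w q)
      after = lefts-linked ℓ up u rest rule joins increasing belows z
                (inj₂ (path⇒strictAncestor e u up z (proj₂ (proj₂ exit-w)) , path-tail (proj₂ (proj₂ exit-w)) ,
                       ci w , w≤u , exit⇒agreesWithParent ℓ u e w z joined (proj₁ exit-w) , w<rest))

lemma3 : (k m : ℕ) (T : CTree k m) (c : ℕ) (ℓ : Side) →
    IsPCRTree T → ChainProperty T → IsConcatTree T c →
    (j : Fin (length (RCL ℓ T))) →
    let Nj = lookup (RCL ℓ T) j
        Np = lookup (RCL ℓ T) (cpred j)
        αj = toList (labOf k m (proj₂ Nj))
        cj = ciOf k m (proj₂ Nj)
        αp = toList (labOf k m (proj₂ Np))
        β₁ = take (cj ∸ 1) αj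
        β₂ = drop cj αj
    in ¬ Ancestor (proj₂ Nj) Np →
    Σ (Edge k m) λ e → Σ (CTree k m) λ P → Σ (Up {k} {m}) λ rest →
      proj₁ Nj ≡ (e , P) ∷ rest ×
      Σ (Sym k m) λ y′ →
        toList (labOf k m P) ≡ β₁ ++ y′ ∷ β₂ ×
        (ℓ ≡ left → IsSuffixOf (y′ ∷ β₂) αp) ×
        (ℓ ≡ right → IsSuffixOf (first rest y′ (β₂ ++ β₁) ∷ β₂) αp)
lemma3 k m T c ℓ _ _ ((1≤c , c≤n) , _ , ci≡c , below) =
  LinkedFrom-cyclic (RCL ℓ T) ([] , T) (proj₁ (block k m ℓ [] T root below last) (exit⇒root-entry k m ℓ T last exit))
  where
  root : ParentRule k m [] T
  root = subst (1 ≤_) (sym ci≡c) 1≤c , subst (_≤ suc m) (sym ci≡c) c≤n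
  last : Node k m
  last = lastFrom ([] , T) (RCL ℓ T)
  exit : Exit k m ℓ [] T last
  exit = proj₂ (block k m ℓ [] T root below ([] , T))
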